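{- Let $n\geq 1$ and $m\geq 2$. The maps $s_0,\dots,s_m$ on the vertex set of $Y_{n,m}$ satisfy the Coxeter relations of the affine Weyl group $\tilde C_m$: $s_i^2=\mathrm{Id}$ for $0\leq i\leq m$; $(s_is_j)^2=\mathrm{Id}$ for $|i-j|>1$; $(s_is_{i+1})^3=\mathrm{Id}$ for $1\leq i\leq m-2$; and $(s_0s_1)^4=(s_{m-1}s_m)^4=\mathrm{Id}$.
   Context: For integers $n\geq 1$, $m\geq 1$, the Yoke graph $Y_{n,m}$ has vertices the tuples $v=(v_0,\dots,v_{m+1})$ with $v_0,v_{m+1}\in\mathbb{Z}_n$, $v_1,\dots,v_m\in\{0,1\}$ and $\sum v_i\equiv0\pmod n$. Define maps $s_i$ on vertices: $s_0(v)=(v_0+1,0,v_2,\dots,v_{m+1})$ if $v_1=1$ and $s_0(v)=(v_0-1,1,v_2,\dots,v_{m+1})$ if $v_1=0$; $s_m(v)=(v_0,\dots,v_{m-1},1,v_{m+1}-1)$ if $v_m=0$ and $s_m(v)=(v_0,\dots,v_{m-1},0,v_{m+1}+1)$ if $v_m=1$ (bucket arithmetic in $\mathbb{Z}_n$); and for $1\leq i\leq m-1$, $s_i$ swaps the entries $v_i$ and $v_{i+1}$. -}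

module Defs where

open import Data.Nat using (ℕ; zero; suc; _+_; _∸_; _≡ᵇ_; _<ᵇ_; NonZero)
open import Data.Nat.DivMod using (_mod_; _%_)
open import Data.Bool using (Bool; true; false; if_then_else_)
open import Data.Fin using (Fin; toℕ)
open import Data.Vec using (Vec; []; _∷_; count)
open import Data.Product using (_×_; _,_)
open import Relation.Binary.PropositionalEquality using (_≡_)
open import Function using (_∘_; id)

-- ℤ_n is represented by Fin n (n ≥ 1 via NonZero n)
inc : (n : ℕ) .{{_ : NonZero n}} → Fin n → Fin n
inc n a = (toℕ a + 1) mod n

dec : (n : ℕ) .{{_ : NonZero n}} → Fin n → Fin n
dec n a = (toℕ a + (n ∸ 1)) mod n

-- raw tuples (v₀ , (v₁ … v_m) , v_{m+1})
Tuple : ℕ → ℕ → Set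
Tuple n m = Fin n × Vec Bool m × Fin n

bit : Bool → ℕ
bit true = 1
bit false = 0

sumBits : ∀ {m} → Vec Bool m → ℕ
sumBits [] = 0
sumBits (x ∷ xs) = bit x + sumBits xs

IsVertex : (n m : ℕ) .{{_ : NonZero n}} → Tuple n m → Set
IsVertex n m (a , bs , b) = (toℕ a + sumBits bs + toℕ b) % n ≡ 0

lastBit : ∀ {m} → Vec Bool m → Bool
lastBit [] = false
lastBit (x ∷ []) = x
lastBit (x ∷ y ∷ xs) = lastBit (y ∷ xs)

flipBit : Bool → Bool
flipBit true = false
flipBit false = true

flipLast : ∀ {m} → Vec Bool m → Vec Bool m
flipLast [] = []
flipLast (x ∷ []) = flipBit x ∷ []
flipLast (x ∷ y ∷ xs) = x ∷ flipLast (y ∷ xs)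

swapAt : ∀ {m} → ℕ → Vec Bool m → Vec Bool m
swapAt zero (x ∷ y ∷ xs) = y ∷ x ∷ xs
swapAt (suc k) (x ∷ xs) = x ∷ swapAt k xs
swapAt _ xs = xs

s₀ : (n m : ℕ) .{{_ : NonZero n}} → Tuple n m → Tuple n m
s₀ n m (a , [] , b) = (a , [] , b)
s₀ n m (a , true ∷ bs , b) = (inc n a , false ∷ bs , b)
s₀ n m (a , false ∷ bs , b) = (dec n a , true ∷ bs , b)

sₘ : (n m : ℕ) .{{_ : NonZero n}} → Tuple n m → Tuple n m
sₘ n m (a , bs , b) with lastBit bs
... | false = (a , flipLast bs , dec n b)
... | true  = (a , flipLast bs , inc n b)

-- s i for 0 ≤ i ≤ m  (for 1 ≤ i ≤ m-1: swap entries v_i and v_{i+1});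
-- values of i > m are never used
s : (n m : ℕ) .{{_ : NonZero n}} → ℕ → Tuple n m → Tuple n m
s n m zero = s₀ n m
s n m (suc k) =
  if suc k ≡ᵇ m then sₘ n m
  else (λ { (a , bs , b) → (a , swapAt k bs , b) })

_^[_] : ∀ {A : Set} → (A → A) → ℕ → A → A
f ^[ zero ] = id
f ^[ suc k ] = f ∘ (f ^[ k ])

{-# OPTIONS --safe #-}
-- Each generator acts on the bit string by a swap of adjacent
-- entries (i = 1 … m-1) or by toggling an end bit and compensating in the
-- adjacent bucket so that the total sum is preserved (i = 0, m).  Swaps satisfy the
-- symmetric-group relations, distant generators touch disjoint coordinates,
-- and the two relations of order four reduce to a computation on the two
-- end bits and their bucket: going once around, the bucket moves by
-- +1 +1 -1 -1 in some order.
module Submission where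

open import Defs
open import Data.Bool using (Bool; true; false)
open import Data.Empty using (⊥-elim)
open import Data.Fin using (Fin; toℕ)
open import Data.Fin.Properties using (toℕ-fromℕ<; toℕ-injective; toℕ<n)
open import Data.Nat using (ℕ; zero; suc; _+_; _∸_; _≤_; _<_; NonZero; >-nonZero⁻¹; s≤s; _%_; _≡ᵇ_)
open import Data.Nat.DivMod using (_mod_; %-distribˡ-+; m%n%n≡m%n; [m+n]%n≡m%n; m<n⇒m%n≡m)
open import Data.Nat.Properties
  using (m+[n∸m]≡n; +-assoc; +-comm; m≤n⇒m<n∨m≡n; <-trans; <-irrefl; <-asym; n<1+n; ≤-refl)
open import Data.Product using (_×_; _,_)
open import Data.Sum using (_⊎_; inj₁; inj₂)
open import Data.Vec using (Vec; []; _∷_)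
open import Function using (_∘_; id)
open import Relation.Binary.PropositionalEquality
open ≡-Reasoning

^[]-intertwine : ∀ {A B : Set} {f : B → B} {g : A → A} {h : A → B} →
  (∀ x → f (h x) ≡ h (g x)) → ∀ k x → (f ^[ k ]) (h x) ≡ h ((g ^[ k ]) x)
^[]-intertwine e zero    x = refl
^[]-intertwine {f = f} {g} e (suc k) x = trans (cong f (^[]-intertwine e k x)) (e ((g ^[ k ]) x))

^[]-cong : ∀ {A : Set} {f g : A → A} → (∀ x → f x ≡ g x) → ∀ k x → (f ^[ k ]) x ≡ (g ^[ k ]) x
^[]-cong = ^[]-intertwine {h = id}

commuting-involutions : ∀ {A : Set} {f g : A → A} →
  (∀ x → f (f x) ≡ x) → (∀ x → g (g x) ≡ x) → (∀ x → f (g x) ≡ g (f x)) →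
  ∀ x → ((f ∘ g) ^[ 2 ]) x ≡ x
commuting-involutions {f = f} {g} f-inv g-inv fg≡gf x = begin
  f (g (f (g x))) ≡⟨ cong f (sym (fg≡gf (g x))) ⟩
  f (f (g (g x))) ≡⟨ f-inv (g (g x)) ⟩
  g (g x)         ≡⟨ g-inv x ⟩
  x               ∎

[m%n+k]%n≡[m+k]%n : ∀ m k n .{{_ : NonZero n}} → (m % n + k) % n ≡ (m + k) % n
[m%n+k]%n≡[m+k]%n m k n = begin
  (m % n + k) % n         ≡⟨ %-distribˡ-+ (m % n) k n ⟩
  (m % n % n + k % n) % n ≡⟨ cong (λ r → (r + k % n) % n) (m%n%n≡m%n m n) ⟩
  (m % n + k % n) % n     ≡⟨ %-distribˡ-+ m k n ⟨
  (m + k) % n             ∎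

swapAt-involutive : ∀ {m} k (xs : Vec Bool m) → swapAt k (swapAt k xs) ≡ xs
swapAt-involutive zero    []           = refl
swapAt-involutive zero    (x ∷ [])     = refl
swapAt-involutive zero    (x ∷ y ∷ xs) = refl
swapAt-involutive (suc k) []           = refl
swapAt-involutive (suc k) (x ∷ xs)     = cong (x ∷_) (swapAt-involutive k xs)

swapAt-comm : ∀ {m} k l → suc k < l → (xs : Vec Bool m) →
  swapAt k (swapAt l xs) ≡ swapAt l (swapAt k xs)
swapAt-comm zero    (suc zero)    (s≤s ()) _
swapAt-comm zero    (suc (suc l)) _       []           = refl
swapAt-comm zero    (suc (suc l)) _       (x ∷ [])     = refl
swapAt-comm zero    (suc (suc l)) _       (x ∷ y ∷ xs) = refl
swapAt-comm (suc k) (suc l)       _       []           = refl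
swapAt-comm (suc k) (suc l)       (s≤s p) (x ∷ xs)     = cong (x ∷_) (swapAt-comm k l p xs)

swapAt-braid : ∀ {m} k → suc (suc k) < m → (xs : Vec Bool m) →
  ((swapAt k ∘ swapAt (suc k)) ^[ 3 ]) xs ≡ xs
swapAt-braid zero    (s≤s (s≤s (s≤s _))) (x ∷ y ∷ z ∷ xs) = refl
swapAt-braid (suc k) (s≤s p)             (x ∷ xs)         = cong (x ∷_) (swapAt-braid k p xs)

flipLast-cons : ∀ {m} x (xs : Vec Bool (suc m)) → flipLast (x ∷ xs) ≡ x ∷ flipLast xs
flipLast-cons x (y ∷ xs) = refl

lastBit-cons : ∀ {m} x (xs : Vec Bool (suc m)) → lastBit (x ∷ xs) ≡ lastBit xs
lastBit-cons x (y ∷ xs) = refl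

flipLast-involutive : ∀ {m} (xs : Vec Bool m) → flipLast (flipLast xs) ≡ xs
flipLast-involutive []           = refl
flipLast-involutive (true ∷ [])  = refl
flipLast-involutive (false ∷ []) = refl
flipLast-involutive (x ∷ y ∷ xs) =
  trans (flipLast-cons x (flipLast (y ∷ xs))) (cong (x ∷_) (flipLast-involutive (y ∷ xs)))

lastBit-flipLast : ∀ {m} (xs : Vec Bool (suc m)) → lastBit (flipLast xs) ≡ flipBit (lastBit xs)
lastBit-flipLast (true ∷ [])  = refl
lastBit-flipLast (false ∷ []) = refl
lastBit-flipLast (x ∷ y ∷ xs) =
  trans (lastBit-cons x (flipLast (y ∷ xs))) (lastBit-flipLast (y ∷ xs))

lastBit-swapAt : ∀ {m} k → suc (suc k) < m → (xs : Vec Bool m) → lastBit (swapAt k xs) ≡ lastBit xs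
lastBit-swapAt zero    (s≤s (s≤s (s≤s _))) (x ∷ y ∷ z ∷ xs) = refl
lastBit-swapAt (suc k) (s≤s p)             (x ∷ y ∷ xs)     =
  trans (lastBit-cons x (swapAt k (y ∷ xs))) (lastBit-swapAt k p (y ∷ xs))

flipLast-swapAt : ∀ {m} k → suc (suc k) < m → (xs : Vec Bool m) →
  flipLast (swapAt k xs) ≡ swapAt k (flipLast xs)
flipLast-swapAt zero    (s≤s (s≤s (s≤s _))) (x ∷ y ∷ z ∷ xs) = refl
flipLast-swapAt (suc k) (s≤s p)             (x ∷ y ∷ xs)     =
  trans (flipLast-cons x (swapAt k (y ∷ xs))) (cong (x ∷_) (flipLast-swapAt k p (y ∷ xs)))

module Buckets (n : ℕ) .{{_ : NonZero n}} where

  shift : ℕ → Fin n → Fin n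
  shift k a = (toℕ a + k) mod n

  shift-shift-cancel : ∀ k l → k + l ≡ n → ∀ a → shift l (shift k a) ≡ a
  shift-shift-cancel k l k+l≡n a = toℕ-injective (begin
    toℕ (shift l (shift k a))          ≡⟨ toℕ-fromℕ< _ ⟩
    (toℕ (shift k a) + l) % n          ≡⟨ cong (λ r → (r + l) % n) (toℕ-fromℕ< _) ⟩
    ((toℕ a + k) % n + l) % n          ≡⟨ [m%n+k]%n≡[m+k]%n (toℕ a + k) l n ⟩
    (toℕ a + k + l) % n                ≡⟨ cong (_% n) (trans (+-assoc (toℕ a) k l) (cong (toℕ a +_) k+l≡n)) ⟩
    (toℕ a + n) % n                    ≡⟨ [m+n]%n≡m%n (toℕ a) n ⟩
    toℕ a % n                          ≡⟨ m<n⇒m%n≡m (toℕ<n a) ⟩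
    toℕ a                              ∎)

  1+[n∸1]≡n : 1 + (n ∸ 1) ≡ n
  1+[n∸1]≡n = m+[n∸m]≡n (>-nonZero⁻¹ n)

  dec-inc : ∀ a → dec n (inc n a) ≡ a
  dec-inc = shift-shift-cancel 1 (n ∸ 1) 1+[n∸1]≡n

  inc-dec : ∀ a → inc n (dec n a) ≡ a
  inc-dec = shift-shift-cancel (n ∸ 1) 1 (trans (+-comm (n ∸ 1) 1) 1+[n∸1]≡n)

≡ᵇ-refl : ∀ k → (k ≡ᵇ k) ≡ true
≡ᵇ-refl zero    = refl
≡ᵇ-refl (suc k) = ≡ᵇ-refl k

<⇒≡ᵇ-false : ∀ {i m} → i < m → (i ≡ᵇ m) ≡ false
<⇒≡ᵇ-false {zero}  {suc m} _       = refl
<⇒≡ᵇ-false {suc i} {suc m} (s≤s p) = <⇒≡ᵇ-false p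

module Generators (n : ℕ) .{{_ : NonZero n}} where
  open Buckets n

  onBits : ∀ {m} → (Vec Bool m → Vec Bool m) → Tuple n m → Tuple n m
  onBits f (a , bs , b) = (a , f bs , b)

  consBit : ∀ {m} → Bool → Tuple n m → Tuple n (suc m)
  consBit z (a , bs , b) = (a , z ∷ bs , b)

  move : Bool → Fin n → Fin n
  move true  = inc n
  move false = dec n

  move-flipBit-move : ∀ x b → move (flipBit x) (move x b) ≡ b
  move-flipBit-move true  = dec-inc
  move-flipBit-move false = inc-dec

  sₘ-unfold : ∀ m a (bs : Vec Bool m) b → sₘ n m (a , bs , b) ≡ (a , flipLast bs , move (lastBit bs) b)
  sₘ-unfold m a bs b with lastBit bs
  ... | true  = refl
  ... | false = refl

  s₀-involutive : ∀ {m} (t : Tuple n m) → s₀ n m (s₀ n m t) ≡ t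
  s₀-involutive (a , []         , b) = refl
  s₀-involutive (a , true  ∷ bs , b) = cong (λ c → (c , true  ∷ bs , b)) (dec-inc a)
  s₀-involutive (a , false ∷ bs , b) = cong (λ c → (c , false ∷ bs , b)) (inc-dec a)

  sₘ-involutive : ∀ m (t : Tuple n (suc m)) → sₘ n (suc m) (sₘ n (suc m) t) ≡ t
  sₘ-involutive m (a , bs , b) = begin
    sₘ n (suc m) (sₘ n (suc m) (a , bs , b))
      ≡⟨ cong (sₘ n (suc m)) (sₘ-unfold (suc m) a bs b) ⟩
    sₘ n (suc m) (a , flipLast bs , move (lastBit bs) b)
      ≡⟨ sₘ-unfold (suc m) a (flipLast bs) _ ⟩
    (a , flipLast (flipLast bs) , move (lastBit (flipLast bs)) (move (lastBit bs) b))
      ≡⟨ cong₂ (λ cs c → (a , cs , c)) (flipLast-involutive bs) bucket ⟩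
    (a , bs , b) ∎
    where
    bucket : move (lastBit (flipLast bs)) (move (lastBit bs) b) ≡ b
    bucket rewrite lastBit-flipLast bs = move-flipBit-move (lastBit bs) b

  sₘ-consBit : ∀ m z (t : Tuple n (suc m)) →
    sₘ n (suc (suc m)) (consBit z t) ≡ consBit z (sₘ n (suc m) t)
  sₘ-consBit m z (a , bs , b) = begin
    sₘ n (suc (suc m)) (a , z ∷ bs , b)
      ≡⟨ sₘ-unfold _ a (z ∷ bs) b ⟩
    (a , flipLast (z ∷ bs) , move (lastBit (z ∷ bs)) b)
      ≡⟨ cong₂ (λ cs c → (a , cs , move c b)) (flipLast-cons z bs) (lastBit-cons z bs) ⟩
    consBit z (a , flipLast bs , move (lastBit bs) b)
      ≡⟨ cong (consBit z) (sₘ-unfold _ a bs b) ⟨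
    consBit z (sₘ n (suc m) (a , bs , b)) ∎

  s₀-swapAt-comm : ∀ {m} k (t : Tuple n m) →
    s₀ n m (onBits (swapAt (suc k)) t) ≡ onBits (swapAt (suc k)) (s₀ n m t)
  s₀-swapAt-comm k (a , []         , b) = refl
  s₀-swapAt-comm k (a , true  ∷ bs , b) = refl
  s₀-swapAt-comm k (a , false ∷ bs , b) = refl

  s₀-sₘ-comm : ∀ m (t : Tuple n (suc (suc m))) → s₀ n _ (sₘ n _ t) ≡ sₘ n _ (s₀ n _ t)
  s₀-sₘ-comm m (a , true ∷ y ∷ ys , b) =
    trans (cong (s₀ n _) (sₘ-unfold _ a (true ∷ y ∷ ys) b)) (sym (sₘ-unfold _ (inc n a) (false ∷ y ∷ ys) b))
  s₀-sₘ-comm m (a , false ∷ y ∷ ys , b) =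
    trans (cong (s₀ n _) (sₘ-unfold _ a (false ∷ y ∷ ys) b)) (sym (sₘ-unfold _ (dec n a) (true ∷ y ∷ ys) b))

  swapAt-sₘ-comm : ∀ m k → suc (suc k) < m → (t : Tuple n m) →
    onBits (swapAt k) (sₘ n m t) ≡ sₘ n m (onBits (swapAt k) t)
  swapAt-sₘ-comm m k p (a , bs , b) = begin
    onBits (swapAt k) (sₘ n m (a , bs , b))
      ≡⟨ cong (onBits (swapAt k)) (sₘ-unfold m a bs b) ⟩
    (a , swapAt k (flipLast bs) , move (lastBit bs) b)
      ≡⟨ cong₂ (λ cs c → (a , cs , move c b)) (flipLast-swapAt k p bs) (lastBit-swapAt k p bs) ⟨
    (a , flipLast (swapAt k bs) , move (lastBit (swapAt k bs)) b)
      ≡⟨ sₘ-unfold m a (swapAt k bs) b ⟨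
    sₘ n m (a , swapAt k bs , b) ∎

  data Generator (m : ℕ) : ℕ → Set where
    left  : Generator m 0
    swap  : ∀ k → suc k < m → Generator m (suc k)
    right : ∀ k → suc k ≡ m → Generator m (suc k)

  generator : ∀ {m i} → i ≤ m → Generator m i
  generator {i = zero}  _ = left
  generator {i = suc k} p with m≤n⇒m<n∨m≡n p
  ... | inj₁ k+1<m = swap k k+1<m
  ... | inj₂ k+1≡m = right k k+1≡m

  act : ∀ {m i} → Generator m i → Tuple n m → Tuple n m
  act {m} left        = s₀ n m
  act     (swap k _)  = onBits (swapAt k)
  act {m} (right _ _) = sₘ n m

  s≗act : ∀ {m i} (g : Generator m i) t → s n m i t ≡ act g t
  s≗act left t = refl
  s≗act (swap k k+1<m) (a , bs , b) rewrite <⇒≡ᵇ-false k+1<m = refl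
  s≗act (right k refl) t rewrite ≡ᵇ-refl k = refl

  act-involutive : ∀ {m i} (g : Generator m i) t → act g (act g t) ≡ t
  act-involutive left           = s₀-involutive
  act-involutive (swap k _)     (a , bs , b) = cong (λ cs → (a , cs , b)) (swapAt-involutive k bs)
  act-involutive (right k refl) = sₘ-involutive k

  act-comm : ∀ {m i j} (g : Generator m i) (h : Generator m j) → suc i < j →
    ∀ t → act g (act h t) ≡ act h (act g t)
  act-comm left (swap zero _) (s≤s ())
  act-comm left (swap (suc k) _) _ = s₀-swapAt-comm k
  act-comm left (right zero _) (s≤s ())
  act-comm left (right (suc k) refl) _ = s₀-sₘ-comm k
  act-comm (swap k _) (swap l _) (s≤s k+1<l) (a , bs , b) =
    cong (λ cs → (a , cs , b)) (swapAt-comm k l k+1<l bs)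
  act-comm {m} (swap k _) (right l refl) k+2<m = swapAt-sₘ-comm m k k+2<m
  act-comm (right k refl) (swap l l+1<m) (s≤s k+1<l) =
    ⊥-elim (<-asym l+1<m (<-trans (n<1+n (suc k)) (s≤s k+1<l)))
  act-comm (right k refl) (right l refl) (s≤s k+1<k) =
    ⊥-elim (<-irrefl refl (<-trans (n<1+n k) k+1<k))

  s-involutive : ∀ {m i} → i ≤ m → ∀ t → s n m i (s n m i t) ≡ t
  s-involutive {m} {i} i≤m t = begin
    s n m i (s n m i t) ≡⟨ cong (s n m i) (s≗act g t) ⟩
    s n m i (act g t)   ≡⟨ s≗act g _ ⟩
    act g (act g t)     ≡⟨ act-involutive g t ⟩
    t                   ∎
    where g = generator i≤m

  s-comm : ∀ {m i j} → i ≤ m → j ≤ m → suc i < j → ∀ t → s n m i (s n m j t) ≡ s n m j (s n m i t)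
  s-comm {m} {i} {j} i≤m j≤m i+1<j t = begin
    s n m i (s n m j t) ≡⟨ cong (s n m i) (s≗act h t) ⟩
    s n m i (act h t)   ≡⟨ s≗act g _ ⟩
    act g (act h t)     ≡⟨ act-comm g h i+1<j t ⟩
    act h (act g t)     ≡⟨ s≗act h _ ⟨
    s n m j (act g t)   ≡⟨ cong (s n m j) (s≗act g t) ⟨
    s n m j (s n m i t) ∎
    where g = generator i≤m
          h = generator j≤m

  s-distant-order2 : ∀ {m i j} → i ≤ m → j ≤ m → suc i < j ⊎ suc j < i →
    ∀ t → ((s n m i ∘ s n m j) ^[ 2 ]) t ≡ t
  s-distant-order2 {m} {i} {j} i≤m j≤m distant =
    commuting-involutions {f = s n m i} {g = s n m j} (s-involutive i≤m) (s-involutive j≤m) (commute distant)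
    where
    commute : suc i < j ⊎ suc j < i → ∀ t → s n m i (s n m j t) ≡ s n m j (s n m i t)
    commute (inj₁ i+1<j) = s-comm i≤m j≤m i+1<j
    commute (inj₂ j+1<i) = sym ∘ s-comm j≤m i≤m j+1<i

  s-braid : ∀ {m} k → suc (suc k) < m → ∀ t → ((s n m (suc k) ∘ s n m (suc (suc k))) ^[ 3 ]) t ≡ t
  s-braid {m} k k+2<m t@(a , bs , b) =
    trans (^[]-cong swaps 3 t) (cong (λ cs → (a , cs , b)) (swapAt-braid k k+2<m bs))
    where
    swaps : ∀ x → s n m (suc k) (s n m (suc (suc k)) x) ≡ onBits (swapAt k) (onBits (swapAt (suc k)) x)
    swaps x = trans (cong (s n m (suc k)) (s≗act (swap (suc k) k+2<m) x))
                    (s≗act (swap k (<-trans (n<1+n (suc k)) k+2<m)) _)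

  s₀-s₁-order4 : ∀ m (t : Tuple n (suc (suc m))) → ((s n (suc (suc m)) 0 ∘ s n (suc (suc m)) 1) ^[ 4 ]) t ≡ t
  s₀-s₁-order4 m (a , true  ∷ true  ∷ bs , b) rewrite dec-inc (inc n a) | dec-inc a = refl
  s₀-s₁-order4 m (a , true  ∷ false ∷ bs , b) rewrite dec-inc (inc n (dec n a)) | inc-dec a = refl
  s₀-s₁-order4 m (a , false ∷ true  ∷ bs , b) rewrite inc-dec (dec n (inc n a)) | dec-inc a = refl
  s₀-s₁-order4 m (a , false ∷ false ∷ bs , b) rewrite inc-dec (dec n a) | inc-dec a = refl

  rightPair : ∀ m → Tuple n (suc (suc m)) → Tuple n (suc (suc m))
  rightPair m = onBits (swapAt m) ∘ sₘ n (suc (suc m))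

  rightPair-consBit : ∀ m z (t : Tuple n (suc (suc m))) →
    rightPair (suc m) (consBit z t) ≡ consBit z (rightPair m t)
  rightPair-consBit m z t = cong (onBits (swapAt (suc m))) (sₘ-consBit (suc m) z t)

  rightPair-order4 : ∀ m (t : Tuple n (suc (suc m))) → (rightPair m ^[ 4 ]) t ≡ t
  rightPair-order4 zero (a , true  ∷ true  ∷ [] , b) rewrite dec-inc (inc n b) | dec-inc b = refl
  rightPair-order4 zero (a , true  ∷ false ∷ [] , b) rewrite dec-inc (inc n (dec n b)) | inc-dec b = refl
  rightPair-order4 zero (a , false ∷ true  ∷ [] , b) rewrite inc-dec (dec n (inc n b)) | dec-inc b = refl
  rightPair-order4 zero (a , false ∷ false ∷ [] , b) rewrite inc-dec (dec n b) | inc-dec b = refl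
  rightPair-order4 (suc m) (a , z ∷ bs , b) =
    trans (^[]-intertwine {f = rightPair (suc m)} {g = rightPair m} {h = consBit z} (rightPair-consBit m z) 4 t)
          (cong (consBit z) (rightPair-order4 m t))
    where t = (a , bs , b)

  sₘ₋₁-sₘ-order4 : ∀ m (t : Tuple n (suc (suc m))) →
    ((s n (suc (suc m)) (suc m) ∘ s n (suc (suc m)) (suc (suc m))) ^[ 4 ]) t ≡ t
  sₘ₋₁-sₘ-order4 m t = trans (^[]-cong unfold 4 t) (rightPair-order4 m t)
    where
    unfold : ∀ x → s n (suc (suc m)) (suc m) (s n (suc (suc m)) (suc (suc m)) x) ≡ rightPair m x
    unfold x = trans (cong (s n _ (suc m)) (s≗act (right (suc m) refl) x)) (s≗act (swap m ≤-refl) _)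

open Generators

proposition3p15 : (n m : ℕ) .{{_ : NonZero n}} → 2 ≤ m →
    ((i : ℕ) → i ≤ m → (v : Tuple n m) → IsVertex n m v →
        (s n m i ^[ 2 ]) v ≡ v)
    × ((i j : ℕ) → i ≤ m → j ≤ m → (suc i < j ⊎ suc j < i) → (v : Tuple n m) → IsVertex n m v →
        ((s n m i ∘ s n m j) ^[ 2 ]) v ≡ v)
    × ((i : ℕ) → 1 ≤ i → i + 2 ≤ m → (v : Tuple n m) → IsVertex n m v →
        ((s n m i ∘ s n m (suc i)) ^[ 3 ]) v ≡ v)
    × ((v : Tuple n m) → IsVertex n m v →
        ((s n m 0 ∘ s n m 1) ^[ 4 ]) v ≡ v)
    × ((k : ℕ) → suc k ≡ m → (v : Tuple n m) → IsVertex n m v →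
        ((s n m k ∘ s n m m) ^[ 4 ]) v ≡ v)
proposition3p15 n (suc (suc m)) (s≤s (s≤s _)) =
    (λ i i≤m v _ → s-involutive n i≤m v)
  , (λ i j i≤m j≤m distant v _ → s-distant-order2 n i≤m j≤m distant v)
  , (λ where
      (suc k) _ k+3≤m v _ → s-braid n k (subst (_≤ suc (suc m)) (+-comm (suc k) 2) k+3≤m) v)
  , (λ v _ → s₀-s₁-order4 n m v)
  , (λ where
      .(suc m) refl v _ → sₘ₋₁-sₘ-order4 n m v)
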